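{- Let $G$ be an interval graph with MPQ-tree $\mathcal{T}$, let $(x,y)\in E(G)$ with $x$ over $y$, where $\mathrm{node}(x)$ is a Q-node with sections $S_1,\dots,S_k$ and $\mathrm{node}(y)$ lies in the subtree $T_a$ of a section $S_a$ with $l(x)<a<r(x)$. If there is a vertex $q\in S_a\setminus(S_{l(x)}\cup S_{r(x)})$, then $(x,y)$ is not an interval edge.
   Context: An interval graph is the intersection graph of a finite family of closed intervals on the real line; an edge $(x,y)$ is an interval edge if $G$ with $(x,y)$ removed is an interval graph. MPQ-trees (Korte–Möhring): a rooted ordered tree of P-nodes and Q-nodes encoding $G$. Each vertex is assigned to exactly one node, $\mathrm{node}(v)$. A P-node carries a (possibly empty) set of vertices. A Q-node with children $T_1,\dots,T_k$ carries sections $S_1,\dots,S_k$; each vertex $v$ assigned to a Q-node lies in the consecutive sections $S_{l(v)},\dots,S_{r(v)}$, at least two of them. For each leaf, the vertices on the root-to-leaf path (P-node sets and, for Q-nodes, the section whose child the path enters) form a maximal clique, each maximal clique arises exactly once, and permuting P-node children and reversing Q-nodes yields exactly the clique orderings in which every vertex is consecutive. $V_i$ is the set of vertices assigned to nodes of $T_i$. The trees considered are those produced by the standard construction and satisfy, for every Q-node with $k$ sections: (a) $V_1,V_k\neq\emptyset$; (b) $S_1\subsetneq S_2$, $S_k\subsetneq S_{k-1}$; (c) $S_{i-1}\cap S_i\neq\emptyset$ for $2\le i\le k$; (d) $S_{i-1}\neq S_i$ for $2\le i\le k$; (e) $(S_i\cap S_{i+1})\setminus S_1\neq\emptyset$ and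 $(S_{i-1}\cap S_i)\setminus S_k\neq\emptyset$ for $2\le i\le k-1$; (f) $(S_{i-1}\cup V_{i-1})\setminus S_i\neq\emptyset$ and $(S_i\cup V_i)\setminus S_{i-1}\neq\emptyset$ for $2\le i\le k$. $x$ is over $y$ if $\mathrm{node}(x)$ is the lowest common ancestor of $\mathrm{node}(x)$ and $\mathrm{node}(y)$.
   Formalization: Interval graphs are taken as intersection graphs of closed intervals with rational endpoints instead of intervals on the real line. -}

module Defs where

open import Data.Nat using (ℕ; zero; suc; _+_)
open import Data.Fin as Fin using (Fin; zero; suc; fromℕ; inject₁; opposite)
open import Data.Fin.Subset using (Subset; _∈_; _∉_; _⊆_; _⊂_; _∩_; _∪_; _─_; ⋃; Nonempty)
import Data.Fin.Subset as Sub
open import Data.Fin.Permutation using (Permutation′; _⟨$⟩ʳ_)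
open import Data.List as List using (List; []; _∷_; [_]; concat; tabulate; lookup; length)
open import Data.List.Relation.Binary.Permutation.Propositional using (_↭_)
open import Data.List.Relation.Unary.Unique.Propositional using (Unique)
open import Data.List.Membership.Propositional using () renaming (_∈_ to _∈ₗ_)
open import Data.Rational using (ℚ) renaming (_≤_ to _≤ℚ_)
open import Data.Product using (Σ; ∃; _×_; _,_)
open import Data.Sum using (_⊎_)
open import Data.Empty using (⊥)
open import Function using (_⇔_)
open import Relation.Nullary using (¬_)
open import Relation.Binary.PropositionalEquality using (_≡_; _≢_)

record Graph (n : ℕ) : Set₁ where
  field
    Adj    : Fin n → Fin n → Set
    sym    : ∀ {u v} → Adj u v → Adj v u
    irrefl : ∀ {v} → ¬ Adj v v
open Graph public

deleteEdge : ∀ {n} → Graph n → Fin n → Fin n → Graph n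
deleteEdge {n} G x y = record { Adj = A ; sym = s ; irrefl = λ a → irrefl G (Data.Product.proj₁ a) }
  where
  Same : Fin n → Fin n → Set
  Same u v = (u ≡ x × v ≡ y) ⊎ (u ≡ y × v ≡ x)
  A : Fin n → Fin n → Set
  A u v = Adj G u v × ¬ Same u v
  s : ∀ {u v} → A u v → A v u
  s (a , ns) = sym G a , λ { (Data.Sum.inj₁ (p , q)) → ns (Data.Sum.inj₂ (q , p))
                           ; (Data.Sum.inj₂ (p , q)) → ns (Data.Sum.inj₁ (q , p)) }

IsIntervalGraph : ∀ {n} → Graph n → Set
IsIntervalGraph {n} G =
  Σ (Fin n → ℚ) λ L → Σ (Fin n → ℚ) λ R →
    (∀ v → L v ≤ℚ R v) ×
    (∀ u v → u ≢ v → (Adj G u v ⇔ (L u ≤ℚ R v × L v ≤ℚ R u)))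

IsClique : ∀ {n} → Graph n → Subset n → Set
IsClique G C = ∀ u v → u ∈ C → v ∈ C → u ≢ v → Adj G u v

IsMaxClique : ∀ {n} → Graph n → Subset n → Set
IsMaxClique G C = IsClique G C × (∀ D → IsClique G D → C ⊆ D → D ≡ C)

-- PQ-trees with vertices assigned to nodes (MPQ-trees)
-- pnode V m cs : P-node carrying vertex set V with m children cs.
-- qnode m S ts : Q-node with k = 2 + m sections S 0 … S (k-1)
--                (0-based; section S_i of the paper is S (i-1)),
--                child subtree T_i = ts (i-1).

data Tree (n : ℕ) : Set where
  pnode : Subset n → (m : ℕ) → (Fin m → Tree n) → Tree n
  qnode : (m : ℕ) → (Fin (2 + m) → Subset n) → (Fin (2 + m) → Tree n) → Tree n

data Pos {n : ℕ} : Tree n → Set where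
  here : ∀ {t} → Pos t
  inP  : ∀ {V m cs} (i : Fin m) → Pos (cs i) → Pos (pnode V m cs)
  inQ  : ∀ {m S ts} (i : Fin (2 + m)) → Pos (ts i) → Pos (qnode m S ts)

subtree : ∀ {n} (t : Tree n) → Pos t → Tree n
subtree t here = t
subtree (pnode V m cs) (inP i p) = subtree (cs i) p
subtree (qnode m S ts) (inQ i p) = subtree (ts i) p

nodeSet : ∀ {n} → Tree n → Subset n
nodeSet (pnode V m cs) = V
nodeSet (qnode m S ts) = ⋃ (tabulate S)

allVerts : ∀ {n} → Tree n → Subset n
allVerts (pnode V m cs) = V ∪ ⋃ (tabulate (λ i → allVerts (cs i)))
allVerts (qnode m S ts) = ⋃ (tabulate S) ∪ ⋃ (tabulate (λ i → allVerts (ts i)))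

-- the cliques read off at the leaves, from left to right;
-- acc = vertices collected on the path so far
leaves : ∀ {n} → Subset n → Tree n → List (Subset n)
leaves acc (pnode V zero cs)    = [ acc ∪ V ]
leaves acc (pnode V (suc m) cs) = concat (tabulate (λ i → leaves (acc ∪ V) (cs i)))
leaves acc (qnode m S ts)       = concat (tabulate (λ i → leaves (acc ∪ S i) (ts i)))

frontier : ∀ {n} → Tree n → List (Subset n)
frontier = leaves Sub.⊥

data _≈T_ {n : ℕ} : Tree n → Tree n → Set where
  pe : ∀ {V m cs cs'} (σ : Permutation′ m) →
       (∀ i → cs (σ ⟨$⟩ʳ i) ≈T cs' i) → pnode V m cs ≈T pnode V m cs'
  qe : ∀ {m S S' ts ts'} → (∀ i → S' i ≡ S i) →
       (∀ i → ts i ≈T ts' i) → qnode m S ts ≈T qnode m S' ts'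
  qr : ∀ {m S S' ts ts'} → (∀ i → S' i ≡ S (opposite i)) →
       (∀ i → ts (opposite i) ≈T ts' i) → qnode m S ts ≈T qnode m S' ts'

Consecutive : ∀ {n} → List (Subset n) → Set
Consecutive {n} O = ∀ (v : Fin n) (i j k : Fin (length O)) →
  i Fin.≤ j → j Fin.≤ k → v ∈ lookup O i → v ∈ lookup O k → v ∈ lookup O j

-- conditions on a Q-node with k = 2 + m sections (0-based indices);
-- consecutive pairs of sections are (inject₁ j , suc j) for j : Fin (1 + m)
QNodeOK : ∀ {n} (m : ℕ) → (Fin (2 + m) → Subset n) → (Fin (2 + m) → Tree n) → Set
QNodeOK {n} m S ts =
  (∀ v → v ∈ ⋃ (tabulate S) →
     (∀ i j k → i Fin.≤ j → j Fin.≤ k → v ∈ S i → v ∈ S k → v ∈ S j) ×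
     (∃ λ i → ∃ λ j → i Fin.< j × v ∈ S i × v ∈ S j)) ×
  Nonempty (V first) × Nonempty (V last) ×
  (S first ⊂ S (suc zero)) × (S last ⊂ S (inject₁ (fromℕ m))) ×
  (∀ j → Nonempty (S (inject₁ j) ∩ S (suc j))) ×
  (∀ j → S (inject₁ j) ≢ S (suc j)) ×
  -- (e)  (pairs (S_i, S_{i+1}) with 2 ≤ i ≤ k-1, resp. (S_{i-1}, S_i) with 2 ≤ i ≤ k-1)
  (∀ j → j ≢ zero → Nonempty ((S (inject₁ j) ∩ S (suc j)) ─ S first)) ×
  (∀ j → j ≢ fromℕ m → Nonempty ((S (inject₁ j) ∩ S (suc j)) ─ S last)) ×
  (∀ j → Nonempty ((S (inject₁ j) ∪ V (inject₁ j)) ─ S (suc j))) ×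
  (∀ j → Nonempty ((S (suc j) ∪ V (suc j)) ─ S (inject₁ j)))
  where
  first last : Fin (2 + m)
  first = zero
  last  = fromℕ (suc m)
  V : Fin (2 + m) → Subset n
  V i = allVerts (ts i)

record IsMPQTree {n : ℕ} (G : Graph n) (T : Tree n) : Set where
  field
    assign     : ∀ v → Σ (Pos T) λ p → v ∈ nodeSet (subtree T p) ×
                   (∀ p' → v ∈ nodeSet (subtree T p') → p' ≡ p)
    leafMax    : ∀ C → C ∈ₗ frontier T → IsMaxClique G C
    maxLeaf    : ∀ C → IsMaxClique G C → C ∈ₗ frontier T
    leafUnique : Unique (frontier T)
    orderings  : ∀ (O : List (Subset n)) →
                   ((O ↭ frontier T) × Consecutive O) ⇔ (∃ λ T' → T ≈T T' × frontier T' ≡ O)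
    qnodes     : ∀ (p : Pos T) {m S ts} → subtree T p ≡ qnode m S ts → QNodeOK m S ts

-- Suppose G − xy had an interval model. The intervals of x and y are disjoint; mirroring the line
-- if necessary, y's lies left of x's. Give every maximal clique M of G a point key M common to the
-- intervals of M, or of M − x when y ∈ M. Sorting the cliques by key yields a consecutive clique
-- ordering; the only delicate vertex is x, and there q does the work: q lies in every clique
-- containing y, every clique containing q contains x, and q stays adjacent to x in G − xy. As y's
-- interval lies left of x's, in this ordering no clique containing x but not y precedes one
-- containing y. But every consecutive ordering is the frontier of a tree equivalent to the MPQ-tree,
-- and however the Q-node is turned, a leaf below S_l (or S_r) containing x but not y precedes a leaf
-- below S_a containing y.

module Submission where

open import Defs hiding (sym)
open import Data.Nat using (ℕ; zero; suc; _+_; s≤s)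
import Data.Nat.Properties as ℕP
open import Data.Fin using (Fin; zero; suc; _≤_; _<_; opposite)
open import Data.Fin.Properties as FinP using (opposite-involutive; opposite-prop; toℕ<n) renaming (_≟_ to _≟ᶠ_; _≤?_ to _≤ᶠ?_)
open import Data.Fin.Subset using (Subset; _∈_; _∉_; _⊆_; _∪_; ⋃; ⁅_⁆)
open import Data.Fin.Subset.Properties using (_∈?_; x∈p∪q⁻; p⊆p∪q; q⊆p∪q; ∉⊥; x∈⁅x⁆; x∈⁅y⁆⇒x≡y; ⊆-reflexive)
open import Data.Fin.Permutation using (Permutation′; _⟨$⟩ʳ_; _⟨$⟩ˡ_; inverseʳ)
open import Data.Rational using (ℚ; -_; 0ℚ) renaming (_≤_ to _≤ℚ_; _<_ to _<ℚ_)
import Data.Rational.Properties as ℚP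
open import Data.List using (List; []; _∷_; _++_; concat; tabulate; lookup; map; filter; allFin)
open import Data.List.Relation.Unary.Any using (Any; here; there)
import Data.List.Relation.Unary.Any.Properties as AnyP
import Data.List.Relation.Unary.All as All
import Data.List.Relation.Unary.All.Properties as AllP
open import Data.List.Relation.Unary.AllPairs using (AllPairs; _∷_)
open import Data.List.Membership.Propositional using (find; lose) renaming (_∈_ to _∈ₗ_)
open import Data.List.Membership.Propositional.Properties using (∈-lookup; ∈-map⁺; ∈-filter⁺; ∈-filter⁻; ∈-allFin)
open import Data.List.Relation.Binary.Permutation.Propositional using (_↭_)
open import Data.List.Relation.Binary.Permutation.Propositional.Properties using (∈-resp-↭)
import Data.List.Relation.Unary.Sorted.TotalOrder.Properties as Sorted
import Data.List.Extrema
open import Data.Product as Product using (∃; ∃₂; _×_; _,_; proj₁; proj₂)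
open import Data.Sum as Sum using (_⊎_; inj₁; inj₂)
open import Data.Empty using (⊥-elim)
open import Function using (_∘_; id; _⇔_; mk⇔; Equivalence)
open import Relation.Nullary using (¬_; Dec; yes; no)
open import Relation.Nullary.Decidable using (decidable-stable; _×-dec_; _→-dec_; ¬?)
open import Relation.Binary.Bundles using (DecTotalOrder)
import Relation.Binary.Construct.On as On
open import Relation.Binary.PropositionalEquality using (_≡_; _≢_; refl; sym; trans; cong; subst; subst₂)
open import Algebra.Properties.Group ℚP.+-0-group using (⁻¹-involutive)

variable
  n k : ℕ
  A : Set

∈⋃⁺ : ∀ {ps : List (Subset n)} {v} → Any (v ∈_) ps → v ∈ ⋃ ps
∈⋃⁺ (here v∈p) = p⊆p∪q _ v∈p
∈⋃⁺ {ps = p ∷ ps} (there v∈ps) = q⊆p∪q p (⋃ ps) (∈⋃⁺ v∈ps)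

∈⋃⁻ : ∀ (ps : List (Subset n)) {v} → v ∈ ⋃ ps → Any (v ∈_) ps
∈⋃⁻ [] v∈ = ⊥-elim (∉⊥ v∈)
∈⋃⁻ (p ∷ ps) v∈ = Sum.[ here , there ∘ ∈⋃⁻ ps ] (x∈p∪q⁻ p (⋃ ps) v∈)

∈⋃-tabulate⁺ : ∀ {f : Fin k → Subset n} {v} i → v ∈ f i → v ∈ ⋃ (tabulate f)
∈⋃-tabulate⁺ i = ∈⋃⁺ ∘ AnyP.tabulate⁺ i

∈⋃-tabulate⁻ : ∀ {f : Fin k → Subset n} {v} → v ∈ ⋃ (tabulate f) → ∃ λ i → v ∈ f i
∈⋃-tabulate⁻ = AnyP.tabulate⁻ ∘ ∈⋃⁻ _

⋃-tabulate-mono : ∀ {k′} {f : Fin k → Subset n} {g : Fin k′ → Subset n} →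
                  (∀ i → ∃ λ j → f i ⊆ g j) → ⋃ (tabulate f) ⊆ ⋃ (tabulate g)
⋃-tabulate-mono f⊆g v∈ with ∈⋃-tabulate⁻ v∈
... | i , v∈fi with f⊆g i
...   | j , fi⊆gj = ∈⋃-tabulate⁺ j (fi⊆gj v∈fi)

∪-mono : ∀ {p p′ q q′ : Subset n} → p ⊆ p′ → q ⊆ q′ → p ∪ q ⊆ p′ ∪ q′
∪-mono p⊆p′ q⊆q′ v∈ = Sum.[ p⊆p∪q _ ∘ p⊆p′ , q⊆p∪q _ _ ∘ q⊆q′ ] (x∈p∪q⁻ _ _ v∈)

∈∪-∉ˡ : ∀ {p q : Subset n} {v} → v ∈ p ∪ q → v ∉ p → v ∈ q
∈∪-∉ˡ v∈ v∉p = Sum.[ ⊥-elim ∘ v∉p , id ] (x∈p∪q⁻ _ _ v∈)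

∉∪ : ∀ {p q : Subset n} {v} → v ∉ p → v ∉ q → v ∉ p ∪ q
∉∪ v∉p v∉q v∈ = v∉q (∈∪-∉ˡ v∈ v∉p)

Any-concat-tabulate⁺ : ∀ {P : A → Set} (f : Fin k → List A) i → Any P (f i) → Any P (concat (tabulate f))
Any-concat-tabulate⁺ f i = AnyP.concat⁺ ∘ AnyP.tabulate⁺ i

Any-concat-tabulate⁻ : ∀ {P : A → Set} (f : Fin k → List A) → Any P (concat (tabulate f)) → ∃ λ i → Any P (f i)
Any-concat-tabulate⁻ f = AnyP.tabulate⁻ ∘ AnyP.concat⁻ (tabulate f)

data AnyBefore (P Q : A → Set) : List A → Set where
  here  : ∀ {x xs} → P x → Any Q xs → AnyBefore P Q (x ∷ xs)
  there : ∀ {x xs} → AnyBefore P Q xs → AnyBefore P Q (x ∷ xs)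

module _ {P Q : A → Set} where

  AnyBefore-++⁺ : ∀ {xs ys} → Any P xs → Any Q ys → AnyBefore P Q (xs ++ ys)
  AnyBefore-++⁺ (here px) qys = here px (AnyP.++⁺ʳ _ qys)
  AnyBefore-++⁺ (there pxs) qys = there (AnyBefore-++⁺ pxs qys)

  AnyBefore-++ˡ : ∀ {xs ys} → AnyBefore P Q xs → AnyBefore P Q (xs ++ ys)
  AnyBefore-++ˡ (here px qxs) = here px (AnyP.++⁺ˡ qxs)
  AnyBefore-++ˡ (there b) = there (AnyBefore-++ˡ b)

  AnyBefore-++ʳ : ∀ xs {ys} → AnyBefore P Q ys → AnyBefore P Q (xs ++ ys)
  AnyBefore-++ʳ [] b = b
  AnyBefore-++ʳ (x ∷ xs) b = there (AnyBefore-++ʳ xs b)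

  AnyBefore-concat-tabulate : ∀ (f : Fin k → List A) i → AnyBefore P Q (f i) → AnyBefore P Q (concat (tabulate f))
  AnyBefore-concat-tabulate f zero b = AnyBefore-++ˡ b
  AnyBefore-concat-tabulate f (suc i) b = AnyBefore-++ʳ (f zero) (AnyBefore-concat-tabulate (f ∘ suc) i b)

  AnyBefore-concat-tabulate₂ : ∀ (f : Fin k → List A) {i j} → i < j → Any P (f i) → Any Q (f j) →
                               AnyBefore P Q (concat (tabulate f))
  AnyBefore-concat-tabulate₂ f {zero} {suc j} _ pfi qfj = AnyBefore-++⁺ pfi (Any-concat-tabulate⁺ (f ∘ suc) j qfj)
  AnyBefore-concat-tabulate₂ f {suc i} {suc j} (s≤s i<j) pfi qfj =
    AnyBefore-++ʳ (f zero) (AnyBefore-concat-tabulate₂ (f ∘ suc) i<j pfi qfj)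

  AnyBefore-AllPairs : ∀ {R : A → A → Set} {xs} → AllPairs R xs → AnyBefore P Q xs →
                       ∃₂ λ c d → c ∈ₗ xs × d ∈ₗ xs × P c × Q d × R c d
  AnyBefore-AllPairs (Rx ∷ _) (here px qxs) with find qxs
  ... | d , d∈ , qd = _ , d , here refl , there d∈ , px , qd , All.lookup Rx d∈
  AnyBefore-AllPairs (_ ∷ Rxs) (there b) with AnyBefore-AllPairs Rxs b
  ... | c , d , c∈ , d∈ , pc , qd , Rcd = c , d , there c∈ , there d∈ , pc , qd , Rcd

opposite-< : ∀ {i j : Fin k} → i < j → opposite j < opposite i
opposite-< {k} {i} {j} i<j rewrite opposite-prop j | opposite-prop i =
  ℕP.∸-monoʳ-< {m = k} (s≤s i<j) (toℕ<n j)

Convex : (Fin k → Set) → Set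
Convex P = ∀ i j j′ → i ≤ j → j ≤ j′ → P i → P j′ → P j

convex-between : ∀ {P : Fin k → Set} {l a r i} → Convex P → P a → ¬ P l → ¬ P r → l < a → a < r →
                 P i → l ≤ i × i ≤ r
convex-between {l = l} {a} {r} {i} convex Pa ¬Pl ¬Pr l<a a<r Pi =
  decidable-stable (l ≤ᶠ? i) (λ l≰i → ¬Pl (convex i l a (ℕP.<⇒≤ (ℕP.≰⇒> l≰i)) (ℕP.<⇒≤ l<a) Pi Pa)) ,
  decidable-stable (i ≤ᶠ? r) (λ i≰r → ¬Pr (convex a r i (ℕP.<⇒≤ a<r) (ℕP.<⇒≤ (ℕP.≰⇒> i≰r)) Pa Pi))

<⇒≱ : ∀ {p q : ℚ} → p <ℚ q → ¬ q ≤ℚ p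
<⇒≱ p<q q≤p = ℚP.<-irrefl refl (ℚP.<-≤-trans p<q q≤p)

neg-cancel-≤ : ∀ {p q : ℚ} → - p ≤ℚ - q → q ≤ℚ p
neg-cancel-≤ {p} {q} -p≤-q = subst₂ _≤ℚ_ (⁻¹-involutive q) (⁻¹-involutive p) (ℚP.neg-antimono-≤ -p≤-q)

maxClique-absorbs : ∀ {G : Graph n} {C v} → IsMaxClique G C → (∀ w → w ∈ C → w ≢ v → Adj G v w) → v ∈ C
maxClique-absorbs {G = G} {C} {v} (clique , maximal) adj = subst (v ∈_) C∪v≡C (q⊆p∪q C ⁅ v ⁆ (x∈⁅x⁆ v))
  where
  C∪v-clique : IsClique G (C ∪ ⁅ v ⁆)
  C∪v-clique u w u∈ w∈ u≢w with x∈p∪q⁻ C ⁅ v ⁆ u∈ | x∈p∪q⁻ C ⁅ v ⁆ w∈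
  ... | inj₁ u∈C | inj₁ w∈C = clique u w u∈C w∈C u≢w
  ... | inj₁ u∈C | inj₂ w∈v with x∈⁅y⁆⇒x≡y v w∈v
  ...   | refl = Graph.sym G (adj u u∈C u≢w)
  C∪v-clique u w u∈ w∈ u≢w | inj₂ u∈v | inj₁ w∈C with x∈⁅y⁆⇒x≡y v u∈v
  ...   | refl = adj w w∈C (u≢w ∘ sym)
  C∪v-clique u w u∈ w∈ u≢w | inj₂ u∈v | inj₂ w∈v = ⊥-elim (u≢w (trans (x∈⁅y⁆⇒x≡y v u∈v) (sym (x∈⁅y⁆⇒x≡y v w∈v))))
  C∪v≡C : C ∪ ⁅ v ⁆ ≡ C
  C∪v≡C = maximal (C ∪ ⁅ v ⁆) C∪v-clique (p⊆p∪q ⁅ v ⁆)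

IntervalModel : Graph n → (L R : Fin n → ℚ) → Set
IntervalModel H L R = (∀ v → L v ≤ℚ R v) × (∀ u v → u ≢ v → (Adj H u v ⇔ (L u ≤ℚ R v × L v ≤ℚ R u)))

mirror : ∀ {H : Graph n} {L R} → IntervalModel H L R → IntervalModel H (-_ ∘ R) (-_ ∘ L)
mirror (L≤R , adj⇔overlap) = ℚP.neg-antimono-≤ ∘ L≤R , λ u v u≢v →
  mk⇔ (λ adj → let (Lu≤Rv , Lv≤Ru) = Equivalence.to (adj⇔overlap u v u≢v) adj
               in ℚP.neg-antimono-≤ Lv≤Ru , ℚP.neg-antimono-≤ Lu≤Rv)
      (λ (-Ru≤-Lv , -Rv≤-Lu) → Equivalence.from (adj⇔overlap u v u≢v) (neg-cancel-≤ -Rv≤-Lu , neg-cancel-≤ -Ru≤-Lv))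

separate : ∀ {H : Graph n} {x y} → x ≢ y → ¬ Adj H x y → IsIntervalGraph H →
           ∃₂ λ L R → IntervalModel H L R × R y <ℚ L x
separate {H = H} {x} {y} x≢y ¬xy (L , R , model) with L x ℚP.≤? R y | L y ℚP.≤? R x
... | no Lx≰Ry | _ = L , R , model , ℚP.≰⇒> Lx≰Ry
... | yes _ | no Ly≰Rx = -_ ∘ R , -_ ∘ L , mirror {H = H} model , ℚP.neg-antimono-< (ℚP.≰⇒> Ly≰Rx)
... | yes Lx≤Ry | yes Ly≤Rx = ⊥-elim (¬xy (Equivalence.from (proj₂ model x y x≢y) (Lx≤Ry , Ly≤Rx)))

module SortBy {A : Set} (key : A → ℚ) where

  private
    keyOrder : DecTotalOrder _ _ _
    keyOrder = On.decTotalOrder ℚP.≤-decTotalOrder key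

  open import Data.List.Sort keyOrder public using (sort; sort-↭)
  open import Data.List.Sort keyOrder using (sort-↗)

  sort-lookup-mono : ∀ xs {i j} → i ≤ j → key (lookup (sort xs) i) ≤ℚ key (lookup (sort xs) j)
  sort-lookup-mono xs = Sorted.lookup-mono-≤ (DecTotalOrder.totalOrder keyOrder) (sort-↗ xs)

  sort-AllPairs : ∀ xs → AllPairs (λ a b → key a ≤ℚ key b) (sort xs)
  sort-AllPairs xs = Sorted.Sorted⇒AllPairs (DecTotalOrder.totalOrder keyOrder) (sort-↗ xs)

sort-consecutive : ∀ (key : Subset n → ℚ) {F} →
  (∀ {M₁ M₂ M₃} → M₁ ∈ₗ F → M₂ ∈ₗ F → M₃ ∈ₗ F → key M₁ ≤ℚ key M₂ → key M₂ ≤ℚ key M₃ →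
     ∀ v → v ∈ M₁ → v ∈ M₃ → v ∈ M₂) →
  Consecutive (SortBy.sort key F)
sort-consecutive key {F} convex v i j j′ i≤j j≤j′ =
  convex (∈F i) (∈F j) (∈F j′) (sort-lookup-mono F i≤j) (sort-lookup-mono F j≤j′) v
  where
  open SortBy key
  ∈F : ∀ i → lookup (sort F) i ∈ₗ F
  ∈F i = ∈-resp-↭ (sort-↭ F) (∈-lookup i)

module CliqueOrdering {n : ℕ} (G : Graph n) {x y q : Fin n} {L R : Fin n → ℚ}
  (model : IntervalModel (deleteEdge G x y) L R) (Ry<Lx : R y <ℚ L x)
  (x≢y : x ≢ y) (q≢x : q ≢ x) (q≢y : q ≢ y)
  {F : List (Subset n)} (maximal : ∀ {M} → M ∈ₗ F → IsMaxClique G M)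
  (y∈⇒x,q∈ : ∀ {M} → M ∈ₗ F → y ∈ M → x ∈ M × q ∈ M)
  (q∈⇒x∈ : ∀ {M} → M ∈ₗ F → q ∈ M → x ∈ M)
  where

  open ℚP.≤-Reasoning
  open Data.List.Extrema (DecTotalOrder.totalOrder ℚP.≤-decTotalOrder) using (min; max; min≤xs; xs≤max; max≤v⁺)

  L≤R : ∀ v → L v ≤ℚ R v
  L≤R = proj₁ model

  y≢x : y ≢ x
  y≢x = x≢y ∘ sym

  overlap⇒adj : ∀ {u w} → u ≢ w → L u ≤ℚ R w → L w ≤ℚ R u → Adj G u w
  overlap⇒adj u≢w Lu≤Rw Lw≤Ru = proj₁ (Equivalence.from (proj₂ model _ _ u≢w) (Lu≤Rw , Lw≤Ru))

  edge-overlap : ∀ {u w} → u ≢ w → Adj G u w → ¬ (u ≡ x × w ≡ y) → ¬ (u ≡ y × w ≡ x) → L w ≤ℚ R u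
  edge-overlap u≢w uw ¬xy ¬yx = proj₂ (Equivalence.to (proj₂ model _ _ u≢w) (uw , Sum.[ ¬xy , ¬yx ]))

  _∈[_] : ℚ → Fin n → Set
  t ∈[ v ] = L v ≤ℚ t × t ≤ℚ R v

  shared-point⇒adj : ∀ {t u w} → t ∈[ u ] → t ∈[ w ] → u ≢ w → Adj G u w
  shared-point⇒adj (Lu≤t , t≤Ru) (Lw≤t , t≤Rw) u≢w = overlap⇒adj u≢w (ℚP.≤-trans Lu≤t t≤Rw) (ℚP.≤-trans Lw≤t t≤Ru)

  ∈[]-between : ∀ {t₁ t₂ t₃ v} → t₁ ≤ℚ t₂ → t₂ ≤ℚ t₃ → t₁ ∈[ v ] → t₃ ∈[ v ] → t₂ ∈[ v ]
  ∈[]-between t₁≤t₂ t₂≤t₃ (Lv≤t₁ , _) (_ , t₃≤Rv) = ℚP.≤-trans Lv≤t₁ t₁≤t₂ , ℚP.≤-trans t₂≤t₃ t₃≤Rv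

  K : Subset n → Fin n → Set
  K M w = w ∈ M × (y ∈ M → w ≢ x)

  K? : ∀ M w → Dec (K M w)
  K? M w = w ∈? M ×-dec (y ∈? M →-dec ¬? (w ≟ᶠ x))

  K-overlap : ∀ {M u w} → M ∈ₗ F → K M u → K M w → L w ≤ℚ R u
  K-overlap {M} {u} {w} M∈ (u∈M , u-ok) (w∈M , w-ok) with u ≟ᶠ w
  ... | yes refl = L≤R u
  ... | no u≢w = edge-overlap u≢w (proj₁ (maximal M∈) u w u∈M w∈M u≢w)
                   (λ (u≡x , w≡y) → u-ok (subst (_∈ M) w≡y w∈M) u≡x)
                   (λ (u≡y , w≡x) → w-ok (subst (_∈ M) u≡y u∈M) w≡x)

  -- abstract, so that a later `with y ∈? M` does not also abstract the test hidden inside key M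
  abstract

    -- 0ℚ only seeds min; all that matters is floor≤L
    floor : ℚ
    floor = min 0ℚ (map L (allFin n))

    floor≤L : ∀ v → floor ≤ℚ L v
    floor≤L v = All.lookup (min≤xs 0ℚ (map L (allFin n))) (∈-map⁺ L (∈-allFin v))

    key : Subset n → ℚ
    key M = max floor (map L (filter (K? M) (allFin n)))

    key-≥ : ∀ {M v} → K M v → L v ≤ℚ key M
    key-≥ {M} {v} v∈K = All.lookup (xs≤max floor (map L (filter (K? M) (allFin n))))
                                   (∈-map⁺ L (∈-filter⁺ (K? M) (∈-allFin v) v∈K))

    key-≤ : ∀ {M v} → M ∈ₗ F → K M v → key M ≤ℚ R v
    key-≤ {M} {v} M∈ v∈K = max≤v⁺ {xs = map L (filter (K? M) (allFin n))} (ℚP.≤-trans (floor≤L v) (L≤R v))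
      (AllP.map⁺ (All.tabulate (λ w∈ → K-overlap M∈ v∈K (proj₂ (∈-filter⁻ (K? M) {xs = allFin n} w∈)))))

  key-∈ : ∀ {M v} → M ∈ₗ F → K M v → key M ∈[ v ]
  key-∈ M∈ v∈K = key-≥ v∈K , key-≤ M∈ v∈K

  covered-adj : ∀ {M v w} → M ∈ₗ F → key M ∈[ v ] → K M w → w ≢ v → Adj G v w
  covered-adj M∈ k∈v w∈K w≢v = shared-point⇒adj k∈v (key-∈ M∈ w∈K) (w≢v ∘ sym)

  covered⇒∈ : ∀ {M v} → M ∈ₗ F → key M ∈[ v ] → (y ∈ M → v ≢ x → Adj G v x) → v ∈ M
  covered⇒∈ {M} {v} M∈ k∈v x-adj = maxClique-absorbs {G = G} (maximal M∈) adj
    where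
    adj : ∀ w → w ∈ M → w ≢ v → Adj G v w
    adj w w∈M w≢v with w ≟ᶠ x | y ∈? M
    ... | yes refl | yes y∈M = x-adj y∈M (w≢v ∘ sym)
    ... | yes refl | no y∉M = covered-adj M∈ k∈v (w∈M , ⊥-elim ∘ y∉M) w≢v
    ... | no w≢x | _ = covered-adj M∈ k∈v (w∈M , λ _ → w≢x) w≢v

  covered∧y∉⇒∈ : ∀ {M v} → M ∈ₗ F → y ∉ M → key M ∈[ v ] → v ∈ M
  covered∧y∉⇒∈ M∈ y∉M k∈v = covered⇒∈ M∈ k∈v (λ y∈M → ⊥-elim (y∉M y∈M))

  Lx≤Rq : ∀ {M} → M ∈ₗ F → y ∈ M → L x ≤ℚ R q
  Lx≤Rq M∈ y∈M with y∈⇒x,q∈ M∈ y∈M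
  ... | x∈M , q∈M = edge-overlap q≢x (proj₁ (maximal M∈) q x q∈M x∈M q≢x) (q≢x ∘ proj₁) (q≢y ∘ proj₁)

  key≤Rx : ∀ {M} → M ∈ₗ F → x ∈ M → key M ≤ℚ R x
  key≤Rx {M} M∈ x∈M with y ∈? M
  ... | no y∉M = key-≤ M∈ (x∈M , ⊥-elim ∘ y∉M)
  ... | yes y∈M = begin
    key M ≤⟨ key-≤ M∈ (y∈M , λ _ → y≢x) ⟩
    R y   <⟨ Ry<Lx ⟩
    L x   ≤⟨ L≤R x ⟩
    R x   ∎

  -- If key M₂ < L x, then y ∈ M₁, and q, whose interval spans key M₁ … L x, lies in M₂.
  x-between : ∀ {M₁ M₂ M₃} → M₁ ∈ₗ F → M₂ ∈ₗ F → M₃ ∈ₗ F → key M₁ ≤ℚ key M₂ → key M₂ ≤ℚ key M₃ →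
              x ∈ M₁ → x ∈ M₃ → x ∈ M₂
  x-between {M₁} {M₂} M₁∈ M₂∈ M₃∈ k₁≤k₂ k₂≤k₃ x∈M₁ x∈M₃ with y ∈? M₂ | L x ℚP.≤? key M₂
  ... | yes y∈M₂ | _ = proj₁ (y∈⇒x,q∈ M₂∈ y∈M₂)
  ... | no y∉M₂ | yes Lx≤k₂ = covered∧y∉⇒∈ M₂∈ y∉M₂ (Lx≤k₂ , ℚP.≤-trans k₂≤k₃ (key≤Rx M₃∈ x∈M₃))
  ... | no y∉M₂ | no Lx≰k₂ = q∈⇒x∈ M₂∈ (covered∧y∉⇒∈ M₂∈ y∉M₂ k₂∈q)
    where
    y∈M₁ : y ∈ M₁
    y∈M₁ = decidable-stable (y ∈? M₁) (λ y∉M₁ → Lx≰k₂ (ℚP.≤-trans (key-≥ (x∈M₁ , ⊥-elim ∘ y∉M₁)) k₁≤k₂))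
    k₂∈q : key M₂ ∈[ q ]
    k₂∈q = ℚP.≤-trans (key-≥ (proj₂ (y∈⇒x,q∈ M₁∈ y∈M₁) , λ _ → q≢x)) k₁≤k₂ ,
           ℚP.≤-trans (ℚP.<⇒≤ (ℚP.≰⇒> Lx≰k₂)) (Lx≤Rq M₁∈ y∈M₁)

  x-adjacent : ∀ {M₂ M₃ v} → M₂ ∈ₗ F → M₃ ∈ₗ F → key M₂ ≤ℚ key M₃ → y ∈ M₂ →
               v ≢ x → v ∈ M₃ → L v ≤ℚ key M₂ → Adj G v x
  x-adjacent {M₂} {M₃} {v} M₂∈ M₃∈ k₂≤k₃ y∈M₂ v≢x v∈M₃ Lv≤k₂ with x ∈? M₃
  ... | yes x∈M₃ = proj₁ (maximal M₃∈) v x v∈M₃ x∈M₃ v≢x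
  ... | no x∉M₃ = overlap⇒adj v≢x
    (begin
      L v   ≤⟨ Lv≤k₂ ⟩
      key M₂ ≤⟨ key-≤ M₂∈ (y∈M₂ , λ _ → y≢x) ⟩
      R y   <⟨ Ry<Lx ⟩
      L x   ≤⟨ L≤R x ⟩
      R x   ∎)
    (begin
      L x    ≤⟨ Lx≤Rq M₂∈ y∈M₂ ⟩
      R q    <⟨ Rq<k₃ ⟩
      key M₃ ≤⟨ key-≤ M₃∈ (v∈M₃ , λ _ → v≢x) ⟩
      R v    ∎)
    where
    Rq<k₃ : R q <ℚ key M₃
    Rq<k₃ = ℚP.≰⇒> λ k₃≤Rq → x∉M₃ (q∈⇒x∈ M₃∈ (covered∧y∉⇒∈ M₃∈ (x∉M₃ ∘ proj₁ ∘ y∈⇒x,q∈ M₃∈)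
              (ℚP.≤-trans (key-≥ (proj₂ (y∈⇒x,q∈ M₂∈ y∈M₂) , λ _ → q≢x)) k₂≤k₃ , k₃≤Rq)))

  other-between : ∀ {M₁ M₂ M₃ v} → M₁ ∈ₗ F → M₂ ∈ₗ F → M₃ ∈ₗ F → key M₁ ≤ℚ key M₂ → key M₂ ≤ℚ key M₃ →
                  v ≢ x → v ∈ M₁ → v ∈ M₃ → v ∈ M₂
  other-between M₁∈ M₂∈ M₃∈ k₁≤k₂ k₂≤k₃ v≢x v∈M₁ v∈M₃ =
    covered⇒∈ M₂∈ k₂∈v (λ y∈M₂ _ → x-adjacent M₂∈ M₃∈ k₂≤k₃ y∈M₂ v≢x v∈M₃ (proj₁ k₂∈v))
    where
    k₂∈v = ∈[]-between k₁≤k₂ k₂≤k₃ (key-∈ M₁∈ (v∈M₁ , λ _ → v≢x)) (key-∈ M₃∈ (v∈M₃ , λ _ → v≢x))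

  key-convex : ∀ {M₁ M₂ M₃} → M₁ ∈ₗ F → M₂ ∈ₗ F → M₃ ∈ₗ F → key M₁ ≤ℚ key M₂ → key M₂ ≤ℚ key M₃ →
               ∀ v → v ∈ M₁ → v ∈ M₃ → v ∈ M₂
  key-convex M₁∈ M₂∈ M₃∈ k₁≤k₂ k₂≤k₃ v with v ≟ᶠ x
  ... | yes refl = x-between M₁∈ M₂∈ M₃∈ k₁≤k₂ k₂≤k₃
  ... | no v≢x = other-between M₁∈ M₂∈ M₃∈ k₁≤k₂ k₂≤k₃ v≢x

  open SortBy key

  ordering : ∃ λ O → O ↭ F × Consecutive O × ¬ AnyBefore (λ C → x ∈ C × y ∉ C) (y ∈_) O
  ordering = sort F , sort-↭ F , sort-consecutive key key-convex , y-cliques-first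
    where
    y-cliques-first : ¬ AnyBefore (λ C → x ∈ C × y ∉ C) (y ∈_) (sort F)
    y-cliques-first before with AnyBefore-AllPairs (sort-AllPairs F) before
    ... | C , D , _ , D∈ , (x∈C , y∉C) , y∈D , kC≤kD = <⇒≱ Ry<Lx (begin
      L x   ≤⟨ key-≥ (x∈C , ⊥-elim ∘ y∉C) ⟩
      key C ≤⟨ kC≤kD ⟩
      key D ≤⟨ key-≤ (∈-resp-↭ (sort-↭ F) D∈) (y∈D , λ _ → y≢x) ⟩
      R y   ∎)

PlacedOnce : Tree n → Fin n → Set
PlacedOnce t v = ∀ (p p′ : Pos t) → v ∈ nodeSet (subtree t p) → v ∈ nodeSet (subtree t p′) → p ≡ p′

allVerts-pchild : ∀ {m} V (cs : Fin m → Tree n) i {v} → v ∈ allVerts (cs i) → v ∈ allVerts (pnode V m cs)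
allVerts-pchild V cs i = q⊆p∪q V _ ∘ ∈⋃-tabulate⁺ {f = allVerts ∘ cs} i

allVerts-qchild : ∀ {m} S (ts : Fin (2 + m) → Tree n) i {v} → v ∈ allVerts (ts i) → v ∈ allVerts (qnode m S ts)
allVerts-qchild S ts i = q⊆p∪q (⋃ (tabulate S)) _ ∘ ∈⋃-tabulate⁺ {f = allVerts ∘ ts} i

allVerts-section : ∀ {m} S (ts : Fin (2 + m) → Tree n) i {v} → v ∈ S i → v ∈ allVerts (qnode m S ts)
allVerts-section S ts i = p⊆p∪q _ ∘ ∈⋃-tabulate⁺ {f = S} i

allVerts-subtree : ∀ (t : Tree n) p {v} → v ∈ allVerts (subtree t p) → v ∈ allVerts t
allVerts-subtree t here = id
allVerts-subtree (pnode V m cs) (inP i p) = allVerts-pchild V cs i ∘ allVerts-subtree (cs i) p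
allVerts-subtree (qnode m S ts) (inQ i p) = allVerts-qchild S ts i ∘ allVerts-subtree (ts i) p

allVerts⇒position : ∀ (t : Tree n) {v} → v ∈ allVerts t → ∃ λ p → v ∈ nodeSet (subtree t p)
allVerts⇒position (pnode V m cs) v∈ with x∈p∪q⁻ V _ v∈
... | inj₁ v∈V = here , v∈V
... | inj₂ v∈cs with ∈⋃-tabulate⁻ v∈cs
...   | i , v∈i = Product.map (inP i) id (allVerts⇒position (cs i) v∈i)
allVerts⇒position (qnode m S ts) v∈ with x∈p∪q⁻ (⋃ (tabulate S)) _ v∈
... | inj₁ v∈S = here , v∈S
... | inj₂ v∈ts with ∈⋃-tabulate⁻ v∈ts
...   | i , v∈i = Product.map (inQ i) id (allVerts⇒position (ts i) v∈i)

leaves-pnode⁺ : ∀ {m} {P : Subset n → Set} V (cs : Fin (suc m) → Tree n) acc i →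
                Any P (leaves (acc ∪ V) (cs i)) → Any P (leaves acc (pnode V (suc m) cs))
leaves-pnode⁺ V cs acc = Any-concat-tabulate⁺ (λ i → leaves (acc ∪ V) (cs i))

leaves-pnode⁻ : ∀ {m} {P : Subset n → Set} V (cs : Fin (suc m) → Tree n) acc →
                Any P (leaves acc (pnode V (suc m) cs)) → ∃ λ i → Any P (leaves (acc ∪ V) (cs i))
leaves-pnode⁻ V cs acc = Any-concat-tabulate⁻ (λ i → leaves (acc ∪ V) (cs i))

leaves-qnode⁺ : ∀ {m} {P : Subset n → Set} S (ts : Fin (2 + m) → Tree n) acc i →
                Any P (leaves (acc ∪ S i) (ts i)) → Any P (leaves acc (qnode m S ts))
leaves-qnode⁺ S ts acc = Any-concat-tabulate⁺ (λ i → leaves (acc ∪ S i) (ts i))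

leaves-qnode⁻ : ∀ {m} {P : Subset n → Set} S (ts : Fin (2 + m) → Tree n) acc →
                Any P (leaves acc (qnode m S ts)) → ∃ λ i → Any P (leaves (acc ∪ S i) (ts i))
leaves-qnode⁻ S ts acc = Any-concat-tabulate⁻ (λ i → leaves (acc ∪ S i) (ts i))

leaves-⊇acc : ∀ (t : Tree n) {acc C} → C ∈ₗ leaves acc t → acc ⊆ C
leaves-⊇acc (pnode V zero cs) (here refl) = p⊆p∪q V
leaves-⊇acc (pnode V (suc m) cs) {acc} C∈ with leaves-pnode⁻ V cs acc C∈
... | i , C∈i = leaves-⊇acc (cs i) C∈i ∘ p⊆p∪q V
leaves-⊇acc (qnode m S ts) {acc} C∈ with leaves-qnode⁻ S ts acc C∈
... | i , C∈i = leaves-⊇acc (ts i) C∈i ∘ p⊆p∪q (S i)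

leaves-⊆ : ∀ (t : Tree n) {acc C v} → C ∈ₗ leaves acc t → v ∈ C → v ∈ acc ⊎ v ∈ allVerts t
leaves-⊆ (pnode V zero cs) (here refl) v∈ = Sum.map₂ (p⊆p∪q _) (x∈p∪q⁻ _ V v∈)
leaves-⊆ (pnode V (suc m) cs) {acc} C∈ v∈ with leaves-pnode⁻ V cs acc C∈
... | i , C∈i = Sum.[ Sum.map₂ (p⊆p∪q _) ∘ x∈p∪q⁻ acc V , inj₂ ∘ allVerts-pchild V cs i ] (leaves-⊆ (cs i) C∈i v∈)
leaves-⊆ (qnode m S ts) {acc} C∈ v∈ with leaves-qnode⁻ S ts acc C∈
... | i , C∈i = Sum.[ Sum.map₂ (allVerts-section S ts i) ∘ x∈p∪q⁻ acc (S i) , inj₂ ∘ allVerts-qchild S ts i ]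
                  (leaves-⊆ (ts i) C∈i v∈)

leaves-∉acc : ∀ (t : Tree n) {acc C v} → C ∈ₗ leaves acc t → v ∈ C → v ∉ acc → v ∈ allVerts t
leaves-∉acc t C∈ v∈C v∉acc = Sum.[ ⊥-elim ∘ v∉acc , id ] (leaves-⊆ t C∈ v∈C)

leaves-nonempty : ∀ (t : Tree n) acc → ∃ λ C → C ∈ₗ leaves acc t
leaves-nonempty (pnode V zero cs) acc = _ , here refl
leaves-nonempty (pnode V (suc m) cs) acc = Product.map₂ (leaves-pnode⁺ V cs acc zero) (leaves-nonempty (cs zero) (acc ∪ V))
leaves-nonempty (qnode m S ts) acc = Product.map₂ (leaves-qnode⁺ S ts acc zero) (leaves-nonempty (ts zero) (acc ∪ S zero))

acc⇒leaf : ∀ (t : Tree n) {acc v} → v ∈ acc → Any (v ∈_) (leaves acc t)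
acc⇒leaf t {acc} v∈acc with leaves-nonempty t acc
... | C , C∈ = lose C∈ (leaves-⊇acc t C∈ v∈acc)

allVerts⇒leaf : ∀ (t : Tree n) acc {v} → v ∈ allVerts t → Any (v ∈_) (leaves acc t)
allVerts⇒leaf (pnode V zero cs) acc v∈ with x∈p∪q⁻ V _ v∈
... | inj₁ v∈V = here (q⊆p∪q acc V v∈V)
... | inj₂ v∈⊥ = ⊥-elim (∉⊥ v∈⊥)
allVerts⇒leaf (pnode V (suc m) cs) acc v∈ with x∈p∪q⁻ V _ v∈
... | inj₁ v∈V = leaves-pnode⁺ V cs acc zero (acc⇒leaf (cs zero) (q⊆p∪q acc V v∈V))
... | inj₂ v∈cs with ∈⋃-tabulate⁻ v∈cs
...   | i , v∈i = leaves-pnode⁺ V cs acc i (allVerts⇒leaf (cs i) (acc ∪ V) v∈i)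
allVerts⇒leaf (qnode m S ts) acc v∈ with x∈p∪q⁻ (⋃ (tabulate S)) _ v∈
... | inj₁ v∈S with ∈⋃-tabulate⁻ v∈S
...   | i , v∈i = leaves-qnode⁺ S ts acc i (acc⇒leaf (ts i) (q⊆p∪q acc (S i) v∈i))
allVerts⇒leaf (qnode m S ts) acc v∈ | inj₂ v∈ts with ∈⋃-tabulate⁻ v∈ts
...   | i , v∈i = leaves-qnode⁺ S ts acc i (allVerts⇒leaf (ts i) (acc ∪ S i) v∈i)

pe-children : ∀ {m} {cs cs′ : Fin m → Tree n} (σ : Permutation′ m) →
              (∀ i → cs (σ ⟨$⟩ʳ i) ≈T cs′ i) → ∀ i → cs i ≈T cs′ (σ ⟨$⟩ˡ i)
pe-children {cs = cs} {cs′} σ cs≈ i = subst (λ j → cs j ≈T cs′ (σ ⟨$⟩ˡ i)) (inverseʳ σ) (cs≈ (σ ⟨$⟩ˡ i))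

qr-sections : ∀ {m} {S S′ : Fin (2 + m) → Subset n} →
              (∀ i → S′ i ≡ S (opposite i)) → ∀ i → S′ (opposite i) ≡ S i
qr-sections {S = S} S′≡ i = trans (S′≡ (opposite i)) (cong S (opposite-involutive i))

qr-children : ∀ {m} {ts ts′ : Fin (2 + m) → Tree n} →
              (∀ i → ts (opposite i) ≈T ts′ i) → ∀ i → ts i ≈T ts′ (opposite i)
qr-children {ts = ts} {ts′} ts≈ i = subst (λ j → ts j ≈T ts′ (opposite i)) (opposite-involutive i) (ts≈ (opposite i))

allVerts-pnode-mono : ∀ {V m m′} {cs : Fin m → Tree n} {cs′ : Fin m′ → Tree n} →
                      (∀ i → ∃ λ j → allVerts (cs i) ⊆ allVerts (cs′ j)) →
                      allVerts (pnode V m cs) ⊆ allVerts (pnode V m′ cs′)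
allVerts-pnode-mono {cs = cs} {cs′} cs⊆ = ∪-mono id (⋃-tabulate-mono {f = allVerts ∘ cs} {g = allVerts ∘ cs′} cs⊆)

allVerts-qnode-mono : ∀ {m m′ S S′} {ts : Fin (2 + m) → Tree n} {ts′ : Fin (2 + m′) → Tree n} →
                      (∀ i → ∃ λ j → S i ⊆ S′ j) → (∀ i → ∃ λ j → allVerts (ts i) ⊆ allVerts (ts′ j)) →
                      allVerts (qnode m S ts) ⊆ allVerts (qnode m′ S′ ts′)
allVerts-qnode-mono {S = S} {S′} {ts} {ts′} S⊆ ts⊆ =
  ∪-mono (⋃-tabulate-mono {f = S} {g = S′} S⊆) (⋃-tabulate-mono {f = allVerts ∘ ts} {g = allVerts ∘ ts′} ts⊆)

allVerts-≈ : ∀ {t t′ : Tree n} → t ≈T t′ → allVerts t ⊆ allVerts t′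
allVerts-≈ {t = pnode V m cs} {pnode _ _ cs′} (pe σ cs≈) = allVerts-pnode-mono {cs = cs} {cs′} λ i →
  σ ⟨$⟩ˡ i , allVerts-≈ (cs≈ (σ ⟨$⟩ˡ i)) ∘ ⊆-reflexive (cong (allVerts ∘ cs) (sym (inverseʳ σ)))
allVerts-≈ {t = qnode m S ts} {qnode _ S′ ts′} (qe S′≡ ts≈) = allVerts-qnode-mono {S = S} {S′} {ts} {ts′}
  (λ i → i , ⊆-reflexive (sym (S′≡ i)))
  (λ i → i , allVerts-≈ (ts≈ i))
allVerts-≈ {t = qnode m S ts} {qnode _ S′ ts′} (qr S′≡ ts≈) = allVerts-qnode-mono {S = S} {S′} {ts} {ts′}
  (λ i → opposite i , ⊆-reflexive (sym (qr-sections S′≡ i)))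
  (λ i → opposite i , allVerts-≈ (ts≈ (opposite i)) ∘ ⊆-reflexive (cong (allVerts ∘ ts) (sym (opposite-involutive i))))

allVerts-≈⁻ : ∀ {t t′ : Tree n} → t ≈T t′ → allVerts t′ ⊆ allVerts t
allVerts-≈⁻ {t = pnode V m cs} {pnode _ _ cs′} (pe σ cs≈) = allVerts-pnode-mono {cs = cs′} {cs} λ i →
  σ ⟨$⟩ʳ i , allVerts-≈⁻ (cs≈ i)
allVerts-≈⁻ {t = qnode m S ts} {qnode _ S′ ts′} (qe S′≡ ts≈) = allVerts-qnode-mono {S = S′} {S} {ts′} {ts}
  (λ i → i , ⊆-reflexive (S′≡ i))
  (λ i → i , allVerts-≈⁻ (ts≈ i))
allVerts-≈⁻ {t = qnode m S ts} {qnode _ S′ ts′} (qr S′≡ ts≈) = allVerts-qnode-mono {S = S′} {S} {ts′} {ts}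
  (λ i → opposite i , ⊆-reflexive (S′≡ i))
  (λ i → opposite i , allVerts-≈⁻ (ts≈ i))

placedOnce-inP : ∀ {V m} {cs : Fin m → Tree n} {v} j → PlacedOnce (pnode V m cs) v → PlacedOnce (cs j) v
placedOnce-inP j once p p′ v∈p v∈p′ with once (inP j p) (inP j p′) v∈p v∈p′
... | refl = refl

placedOnce-inQ : ∀ {m S} {ts : Fin (2 + m) → Tree n} {v} j → PlacedOnce (qnode m S ts) v → PlacedOnce (ts j) v
placedOnce-inQ j once p p′ v∈p v∈p′ with once (inQ j p) (inQ j p′) v∈p v∈p′
... | refl = refl

placedOnce-subtree : ∀ (t : Tree n) p {v} → PlacedOnce t v → PlacedOnce (subtree t p) v
placedOnce-subtree t here = id
placedOnce-subtree (pnode V m cs) (inP i p) = placedOnce-subtree (cs i) p ∘ placedOnce-inP i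
placedOnce-subtree (qnode m S ts) (inQ i p) = placedOnce-subtree (ts i) p ∘ placedOnce-inQ i

module _ {V m} {cs : Fin m → Tree n} {v} (once : PlacedOnce (pnode V m cs) v) where

  pchild-unique : ∀ {i j} → v ∈ allVerts (cs i) → v ∈ allVerts (cs j) → i ≡ j
  pchild-unique {i} {j} v∈i v∈j with allVerts⇒position (cs i) v∈i | allVerts⇒position (cs j) v∈j
  ... | p , v∈p | p′ , v∈p′ with once (inP i p) (inP j p′) v∈p v∈p′
  ...   | refl = refl

  ∉-pnode-path : ∀ {j acc} → v ∈ allVerts (cs j) → v ∉ acc → v ∉ acc ∪ V
  ∉-pnode-path {j} v∈j v∉acc = ∉∪ v∉acc λ v∈V → here≢child (allVerts⇒position (cs j) v∈j) v∈V
    where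
    here≢child : (∃ λ p → v ∈ nodeSet (subtree (cs j) p)) → v ∉ V
    here≢child (p , v∈p) v∈V with once here (inP j p) v∈V v∈p
    ... | ()

  pnode-step : ∀ {i j acc C} → v ∈ allVerts (cs j) → v ∉ acc → C ∈ₗ leaves (acc ∪ V) (cs i) → v ∈ C →
               i ≡ j × v ∉ acc ∪ V
  pnode-step {i} v∈j v∉acc C∈ v∈C =
    pchild-unique (leaves-∉acc (cs i) C∈ v∈C v∉path) v∈j , v∉path
    where
    v∉path = ∉-pnode-path v∈j v∉acc

module _ {m S} {ts : Fin (2 + m) → Tree n} {v} (once : PlacedOnce (qnode m S ts) v) where

  qchild-unique : ∀ {i j} → v ∈ allVerts (ts i) → v ∈ allVerts (ts j) → i ≡ j
  qchild-unique {i} {j} v∈i v∈j with allVerts⇒position (ts i) v∈i | allVerts⇒position (ts j) v∈j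
  ... | p , v∈p | p′ , v∈p′ with once (inQ i p) (inQ j p′) v∈p v∈p′
  ...   | refl = refl

  section-child-disjoint : ∀ {i j} → v ∈ S i → v ∉ allVerts (ts j)
  section-child-disjoint {i} {j} v∈Si v∈j with allVerts⇒position (ts j) v∈j
  ... | p , v∈p with once here (inQ j p) (∈⋃-tabulate⁺ {f = S} i v∈Si) v∈p
  ...   | ()

  ∉-qnode-path : ∀ {i j acc} → v ∈ allVerts (ts j) → v ∉ acc → v ∉ acc ∪ S i
  ∉-qnode-path v∈j v∉acc = ∉∪ v∉acc λ v∈Si → section-child-disjoint v∈Si v∈j

  qnode-step : ∀ {i j acc C} → v ∈ allVerts (ts j) → v ∉ acc → C ∈ₗ leaves (acc ∪ S i) (ts i) → v ∈ C →
               i ≡ j × v ∉ acc ∪ S i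
  qnode-step {i} v∈j v∉acc C∈ v∈C =
    qchild-unique (leaves-∉acc (ts i) C∈ v∈C v∉path) v∈j , v∉path
    where
    v∉path = ∉-qnode-path v∈j v∉acc

leaf-through : ∀ (t : Tree n) (p : Pos t) {acc C v} → PlacedOnce t v → v ∈ allVerts (subtree t p) →
               C ∈ₗ leaves acc t → v ∈ C → v ∉ acc → ∃ λ acc′ → v ∉ acc′ × C ∈ₗ leaves acc′ (subtree t p)
leaf-through t here _ _ C∈ _ v∉acc = _ , v∉acc , C∈
leaf-through (pnode V zero cs) (inP () p)
leaf-through (pnode V (suc m) cs) (inP j p) {acc} once v∈p C∈ v∈C v∉acc with leaves-pnode⁻ V cs acc C∈
... | i , C∈i with pnode-step once (allVerts-subtree (cs j) p v∈p) v∉acc C∈i v∈C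
...   | refl , v∉path = leaf-through (cs i) p (placedOnce-inP i once) v∈p C∈i v∈C v∉path
leaf-through (qnode m S ts) (inQ j p) {acc} once v∈p C∈ v∈C v∉acc with leaves-qnode⁻ S ts acc C∈
... | i , C∈i with qnode-step once (allVerts-subtree (ts j) p v∈p) v∉acc C∈i v∈C
...   | refl , v∉path = leaf-through (ts i) p (placedOnce-inQ i once) v∈p C∈i v∈C v∉path

qnode-leaf-section : ∀ {m S} {ts : Fin (2 + m) → Tree n} {acc C v} → C ∈ₗ leaves acc (qnode m S ts) → v ∈ C → v ∉ acc →
                ∃ λ i → S i ⊆ C × (v ∈ S i ⊎ v ∈ allVerts (ts i))
qnode-leaf-section {S = S} {ts} {acc} C∈ v∈C v∉acc with leaves-qnode⁻ S ts acc C∈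
... | i , C∈i = i , leaves-⊇acc (ts i) C∈i ∘ q⊆p∪q acc (S i) ,
                Sum.map₁ (λ v∈path → ∈∪-∉ˡ v∈path v∉acc) (leaves-⊆ (ts i) C∈i v∈C)

module _ {P Q : Subset n → Set} where

  mutual

    before-≈-subtree : ∀ (t : Tree n) (p : Pos t) {t′ acc v} → t ≈T t′ → PlacedOnce t v →
      v ∈ allVerts (subtree t p) → v ∉ acc →
      (∀ {acc′ t″} → v ∉ acc′ → subtree t p ≈T t″ → AnyBefore P Q (leaves acc′ t″)) →
      AnyBefore P Q (leaves acc t′)
    before-≈-subtree t here t≈t′ _ _ v∉acc at-p = at-p v∉acc t≈t′
    before-≈-subtree (pnode V zero cs) (inP () p) _ _ _ _ _
    before-≈-subtree (pnode V (suc m) cs) (inP j p) {pnode _ _ cs′} {acc} (pe σ cs≈) once v∈p v∉acc at-p =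
      AnyBefore-concat-tabulate (λ i → leaves (acc ∪ V) (cs′ i)) (σ ⟨$⟩ˡ j)
        (before-≈-subtree (cs j) p (pe-children σ cs≈ j) (placedOnce-inP j once) v∈p
           (∉-pnode-path once (allVerts-subtree (cs j) p v∈p) v∉acc) at-p)
    before-≈-subtree (qnode m S ts) (inQ j p) {qnode _ S′ ts′} (qe S′≡ ts≈) once v∈p v∉acc at-p =
      before-≈-qchild {S′ = S′} {ts′ = ts′} id S′≡ ts≈ j p once v∈p v∉acc at-p
    before-≈-subtree (qnode m S ts) (inQ j p) {qnode _ S′ ts′} (qr S′≡ ts≈) once v∈p v∉acc at-p =
      before-≈-qchild {S′ = S′} {ts′ = ts′} opposite (qr-sections S′≡) (qr-children ts≈) j p once v∈p v∉acc at-p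

    before-≈-qchild : ∀ {m S S′} {ts ts′ : Fin (2 + m) → Tree n} {acc v} (π : Fin (2 + m) → Fin (2 + m)) →
      (∀ i → S′ (π i) ≡ S i) → (∀ i → ts i ≈T ts′ (π i)) → ∀ j (p : Pos (ts j)) →
      PlacedOnce (qnode m S ts) v → v ∈ allVerts (subtree (ts j) p) → v ∉ acc →
      (∀ {acc′ t″} → v ∉ acc′ → subtree (ts j) p ≈T t″ → AnyBefore P Q (leaves acc′ t″)) →
      AnyBefore P Q (leaves acc (qnode m S′ ts′))
    before-≈-qchild {S′ = S′} {ts′ = ts′} {acc} {v} π S′≡ ts≈ j p once v∈p v∉acc at-p =
      AnyBefore-concat-tabulate (λ i → leaves (acc ∪ S′ i) (ts′ i)) (π j)
        (before-≈-subtree _ p (ts≈ j) (placedOnce-inQ j once) v∈p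
           (subst (λ X → v ∉ acc ∪ X) (sym (S′≡ j)) (∉-qnode-path once (allVerts-subtree _ p v∈p) v∉acc)) at-p)

before-reindexed : ∀ {m S S′} {ts ts′ : Fin (2 + m) → Tree n} {acc x y e a} (π : Fin (2 + m) → Fin (2 + m)) →
  (∀ i → S′ (π i) ≡ S i) → (∀ i → ts i ≈T ts′ (π i)) → PlacedOnce (qnode m S ts) y →
  x ∈ S e → y ∈ allVerts (ts a) → π e < π a → y ∉ acc →
  AnyBefore (λ C → x ∈ C × y ∉ C) (y ∈_) (leaves acc (qnode m S′ ts′))
before-reindexed {S′ = S′} {ts′ = ts′} {acc} {x} {y} {e} {a} π S′≡ ts≈ once x∈e y∈a πe<πa y∉acc
  with leaves-nonempty (ts′ (π e)) (acc ∪ S′ (π e))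
... | C , C∈ = AnyBefore-concat-tabulate₂ (λ i → leaves (acc ∪ S′ i) (ts′ i)) πe<πa
                 (lose C∈ (x∈C , y∉C)) (allVerts⇒leaf (ts′ (π a)) _ (allVerts-≈ (ts≈ a) y∈a))
  where
  x∈C : x ∈ C
  x∈C = leaves-⊇acc (ts′ (π e)) C∈ (q⊆p∪q acc _ (subst (x ∈_) (sym (S′≡ e)) x∈e))
  y∉path : y ∉ acc ∪ S′ (π e)
  y∉path = subst (λ X → y ∉ acc ∪ X) (sym (S′≡ e)) (∉-qnode-path once y∈a y∉acc)
  y∉C : y ∉ C
  y∉C y∈C = FinP.<-irrefl (cong π (qchild-unique once (allVerts-≈⁻ (ts≈ e) (leaves-∉acc (ts′ (π e)) C∈ y∈C y∉path)) y∈a)) πe<πa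

-- However the Q-node is turned, one section of x (l, or r after reversal) ends up left of a.
before-qnode : ∀ {m S} {ts : Fin (2 + m) → Tree n} {t′ acc x y l a r} → qnode m S ts ≈T t′ →
  PlacedOnce (qnode m S ts) y → x ∈ S l → x ∈ S r → y ∈ allVerts (ts a) → l < a → a < r → y ∉ acc →
  AnyBefore (λ C → x ∈ C × y ∉ C) (y ∈_) (leaves acc t′)
before-qnode {t′ = qnode _ S′ ts′} (qe S′≡ ts≈) once x∈l _ y∈a l<a _ = before-reindexed {S′ = S′} {ts′ = ts′} id S′≡ ts≈ once x∈l y∈a l<a
before-qnode {t′ = qnode _ S′ ts′} (qr S′≡ ts≈) once _ x∈r y∈a _ a<r =
  before-reindexed {S′ = S′} {ts′ = ts′} opposite (qr-sections S′≡) (qr-children ts≈) once x∈r y∈a (opposite-< a<r)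

module MPQFacts {n : ℕ} {G : Graph n} {T : Tree n} (mpq : IsMPQTree G T)
  {px : Pos T} {m : ℕ} {S : Fin (2 + m) → Subset n} {ts : Fin (2 + m) → Tree n}
  (px-qnode : subtree T px ≡ qnode m S ts) where

  open IsMPQTree mpq

  placedOnce : ∀ v → PlacedOnce T v
  placedOnce v p p′ v∈p v∈p′ = trans (proj₂ (proj₂ (assign v)) p v∈p) (sym (proj₂ (proj₂ (assign v)) p′ v∈p′))

  placedOnce-qnode : ∀ v → PlacedOnce (qnode m S ts) v
  placedOnce-qnode v = subst (λ t → PlacedOnce t v) px-qnode (placedOnce-subtree T px (placedOnce v))

  sections-convex : ∀ {v} i → v ∈ S i → Convex (λ j → v ∈ S j)
  sections-convex i v∈i = proj₁ (proj₁ (qnodes px px-qnode) _ (∈⋃-tabulate⁺ {f = S} i v∈i))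

  between-sections : ∀ {v l i r} → v ∈ S l → v ∈ S r → l ≤ i → i ≤ r → v ∈ S i
  between-sections {l = l} v∈l v∈r l≤i i≤r = sections-convex l v∈l _ _ _ l≤i i≤r v∈l v∈r

  nested-sections : ∀ {x q l a r i} → x ∈ S l → x ∈ S r → q ∈ S a → q ∉ S l → q ∉ S r → l < a → a < r →
                    q ∈ S i → x ∈ S i
  nested-sections {a = a} x∈l x∈r q∈a q∉l q∉r l<a a<r q∈i =
    let (l≤i , i≤r) = convex-between (sections-convex a q∈a) q∈a q∉l q∉r l<a a<r q∈i
    in between-sections x∈l x∈r l≤i i≤r

  ∈-allVerts-px : ∀ {v} → v ∈ allVerts (qnode m S ts) → v ∈ allVerts (subtree T px)
  ∈-allVerts-px = subst (λ t → _ ∈ allVerts t) (sym px-qnode)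

  frontier-leaf-section : ∀ {C v} → C ∈ₗ frontier T → v ∈ C → v ∈ allVerts (qnode m S ts) →
                      ∃ λ i → S i ⊆ C × (v ∈ S i ⊎ v ∈ allVerts (ts i))
  frontier-leaf-section C∈ v∈C v∈Q with leaf-through T px (placedOnce _) (∈-allVerts-px v∈Q) C∈ v∈C ∉⊥
  ... | acc , v∉acc , C∈′ = qnode-leaf-section {S = S} {ts} (subst (λ t → _ ∈ₗ leaves acc t) px-qnode C∈′) v∈C v∉acc

  leaf⊇section-of-child-vertex : ∀ {a C v} → v ∈ allVerts (ts a) → C ∈ₗ frontier T → v ∈ C → S a ⊆ C
  leaf⊇section-of-child-vertex {a} v∈a C∈ v∈C with frontier-leaf-section C∈ v∈C (allVerts-qchild S ts a v∈a)
  ... | i , Sᵢ⊆C , inj₁ v∈Sᵢ = ⊥-elim (section-child-disjoint (placedOnce-qnode _) v∈Sᵢ v∈a)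
  ... | i , Sᵢ⊆C , inj₂ v∈i with qchild-unique (placedOnce-qnode _) v∈i v∈a
  ...   | refl = Sᵢ⊆C

  leaf⊇section-of-section-vertex : ∀ {a C v} → v ∈ S a → C ∈ₗ frontier T → v ∈ C → ∃ λ i → v ∈ S i × S i ⊆ C
  leaf⊇section-of-section-vertex {a} v∈a C∈ v∈C with frontier-leaf-section C∈ v∈C (allVerts-section S ts a v∈a)
  ... | i , Sᵢ⊆C , inj₁ v∈Sᵢ = i , v∈Sᵢ , Sᵢ⊆C
  ... | i , _ , inj₂ v∈i = ⊥-elim (section-child-disjoint (placedOnce-qnode _) v∈a v∈i)

  consecutive⇒AnyBefore : ∀ {x y l a r} → x ∈ S l → x ∈ S r → y ∈ allVerts (ts a) → l < a → a < r →
                       ∀ O → O ↭ frontier T → Consecutive O → AnyBefore (λ C → x ∈ C × y ∉ C) (y ∈_) O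
  consecutive⇒AnyBefore {y = y} {a = a} x∈l x∈r y∈a l<a a<r O O↭F consecutive
    with Equivalence.to (orderings O) (O↭F , consecutive)
  ... | T′ , T≈T′ , refl =
    before-≈-subtree T px T≈T′ (placedOnce y) (∈-allVerts-px (allVerts-qchild S ts a y∈a)) ∉⊥ λ y∉acc px≈ →
      before-qnode (subst (_≈T _) px-qnode px≈) (placedOnce-qnode y) x∈l x∈r y∈a l<a a<r y∉acc

lemma20 : ∀ {n} (G : Graph n) (T : Tree n) → IsIntervalGraph G → IsMPQTree G T →
          ∀ (x y : Fin n) → Adj G x y →
          ∀ (px : Pos T) (m : ℕ) (S : Fin (2 Data.Nat.+ m) → Subset n) (ts : Fin (2 Data.Nat.+ m) → Tree n) →
          subtree T px ≡ qnode m S ts → x ∈ nodeSet (subtree T px) →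
          ∀ (l r a : Fin (2 Data.Nat.+ m)) →
          x ∈ S l → x ∈ S r → (∀ i → x ∈ S i → l ≤ i × i ≤ r) →
          y ∈ allVerts (ts a) → l < a → a < r →
          ∀ (q : Fin n) → q ∈ S a → q ∉ S l → q ∉ S r →
          ¬ IsIntervalGraph (deleteEdge G x y)
lemma20 G T _ mpq x y xy px m S ts px-qnode _ l r a x∈l x∈r _ y∈a l<a a<r q q∈a q∉l q∉r G-xy-interval =
  let (L , R , model , Ry<Lx) = separate {H = deleteEdge G x y} x≢y (λ (_ , ¬same) → ¬same (inj₁ (refl , refl))) G-xy-interval
      (O , O↭F , consecutive , ¬before) =
        CliqueOrdering.ordering G model Ry<Lx x≢y q≢x q≢y (IsMPQTree.leafMax mpq _) y∈⇒x,q∈ q∈⇒x∈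
  in ¬before (consecutive⇒AnyBefore x∈l x∈r y∈a l<a a<r O O↭F consecutive)
  where
  open MPQFacts mpq {px = px} px-qnode

  x≢y : x ≢ y
  x≢y refl = irrefl G xy

  q≢x : q ≢ x
  q≢x refl = q∉l x∈l

  q≢y : q ≢ y
  q≢y refl = section-child-disjoint (placedOnce-qnode q) q∈a y∈a

  y∈⇒x,q∈ : ∀ {C} → C ∈ₗ frontier T → y ∈ C → x ∈ C × q ∈ C
  y∈⇒x,q∈ C∈ y∈C = Sₐ⊆C (between-sections x∈l x∈r (ℕP.<⇒≤ l<a) (ℕP.<⇒≤ a<r)) , Sₐ⊆C q∈a
    where
    Sₐ⊆C = leaf⊇section-of-child-vertex y∈a C∈ y∈C

  q∈⇒x∈ : ∀ {C} → C ∈ₗ frontier T → q ∈ C → x ∈ C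
  q∈⇒x∈ C∈ q∈C =
    let (i , q∈i , Sᵢ⊆C) = leaf⊇section-of-section-vertex q∈a C∈ q∈C
    in Sᵢ⊆C (nested-sections x∈l x∈r q∈a q∉l q∉r l<a a<r q∈i)
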